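{- Let $b,m$ be integers larger than $1$ and let $S$ be a finite weighted subset of $[\![b]\!]^*$. Then there exists a finite proper weighted subset $S'$ of $[\![b]\!]^*$ such that $a_{b,m,S}(n)=a_{b,m,S'}(n)$ for every non-negative integer $n$.
   Context: Let $b\ge 2$ and $m\ge 2$ be integers, $[\![b]\!]=\{0,1,\dots,b-1\}$, and $[\![b]\!]^*$ the set of finite words over $[\![b]\!]$. For a non-negative integer $n$ and a word $w\in[\![b]\!]^*$ containing at least one nonzero letter, $e_{b,w}(n)$ denotes the number of occurrences of $w$ as a block of consecutive digits in the base-$b$ expansion of $n$, where the expansion is taken with infinitely many leading zeros (e.g. $e_{2,0011}(6)=1$, $e_{2,0011}(51)=2$). A finite weighted subset $S$ of $[\![b]\!]^*$ is an assignment of a real weight $n_{S,w}$ to each word $w\in[\![b]\!]^*$ such that only finitely many $w$ have $n_{S,w}\neq 0$ (and $n_{S,w}=0$ whenever $w$ consists only of zeros). Define $e_{b,S}(n)=\sum_{w} n_{S,w}\,e_{b,w}(n)$ and $a_{b,m,S}(n)=\exp\!\big(\tfrac{2\pi i\, e_{b,S}(n)}{m}\big)$. A finite weighted subset $S$ is called proper if $n_{S,w}\neq 0$ implies that the first letter of $w$ is not $0$. -}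

module Defs where

open import Level using (Level)
open import Data.Bool using (Bool; true; false; _∧_; _∨_; not)
open import Data.Nat using (ℕ; zero; suc; _+_; NonZero)
open import Data.Nat.DivMod using (_mod_; _/_)
open import Data.Fin using (Fin; toℕ)
open import Data.Fin.Properties using () renaming (_≟_ to _≟F_)
open import Data.List using (List; []; _∷_; length; replicate; reverse; map; foldr)
open import Data.Product using (_×_; _,_; proj₁; proj₂)
open import Data.List.Relation.Unary.All using (All)
open import Relation.Nullary using (¬_)
open import Relation.Nullary.Decidable using (⌊_⌋)
open import Relation.Binary.PropositionalEquality using (_≡_)
open import Algebra.Bundles using (AbelianGroup)
import Algebra.Definitions.RawMonoid as RM

Word : ℕ → Set
Word b = List (Fin b)

-- Little-endian base-b digits of n (no leading zeros; 0 ↦ []).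
-- The first argument is fuel; fuel n suffices since k / b < k.
digitsLE : (b : ℕ) .{{_ : NonZero b}} → ℕ → ℕ → Word b
digitsLE b zero    k       = []
digitsLE b (suc f) zero    = []
digitsLE b (suc f) (suc k) = (suc k mod b) ∷ digitsLE b f (suc k / b)

expansion : (b : ℕ) .{{_ : NonZero b}} → ℕ → Word b
expansion b n = reverse (digitsLE b n n)

isPrefix : ∀ {b} → Word b → Word b → Bool
isPrefix []      s       = true
isPrefix (x ∷ w) []      = false
isPrefix (x ∷ w) (y ∷ s) = ⌊ x ≟F y ⌋ ∧ isPrefix w s

bit : Bool → ℕ
bit true  = 1
bit false = 0

occurrences : ∀ {b} → Word b → Word b → ℕ
occurrences w []      = bit (isPrefix w [])
occurrences w (y ∷ s) = bit (isPrefix w (y ∷ s)) + occurrences w s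

-- e_{b,w}(n): occurrences of w in the base-b expansion of n taken with
-- infinitely many leading zeros.  For a word w containing a nonzero letter,
-- padding the expansion with length w leading zeros captures all occurrences
-- (an occurrence can't lie entirely inside the zero region).
e : (b : ℕ) .{{_ : NonZero b}} → Word b → ℕ → ℕ
e b w n = occurrences w (replicate (length w) (0 mod b) Data.List.++ expansion b n)
  where import Data.List

HasNonzero : ∀ {b} → Word b → Set
HasNonzero []      = Data.Empty.⊥ where import Data.Empty
HasNonzero (x ∷ w) = ¬ (toℕ x ≡ 0) Data.Sum.⊎ HasNonzero w where import Data.Sum

StartsNonzero : ∀ {b} → Word b → Set
StartsNonzero []      = Data.Empty.⊥ where import Data.Empty
StartsNonzero (x ∷ w) = ¬ (toℕ x ≡ 0)

-- Weighted subsets with weights in an abelian group G (the paper: G = ℝ).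
-- A finite weighted subset is given by a finite list of (word, weight)
-- entries; the weight n_{S,w} of a word w is the sum of the weights of the
-- entries with word w.
module _ {c ℓ : Level} (G : AbelianGroup c ℓ) where
  open AbelianGroup G

  WSubset : ℕ → Set c
  WSubset b = List (Word b × Carrier)

  -- Well-formed: every listed word contains a nonzero letter
  -- (so all-zero words get weight 0).
  WellFormed : ∀ {b} → WSubset b → Set c
  WellFormed S = All (λ p → HasNonzero (proj₁ p)) S

  Proper : ∀ {b} → WSubset b → Set c
  Proper S = All (λ p → StartsNonzero (proj₁ p)) S

  open RM rawMonoid using () renaming (_×_ to _·ℕ_)

  eS : (b : ℕ) .{{_ : NonZero b}} → WSubset b → ℕ → Carrier
  eS b []            n = ε
  eS b ((w , x) ∷ S) n = (e b w n ·ℕ x) ∙ eS b S n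

-- Since e pads the expansion with as many zeros as the word is long, the
-- padded string for a ∷ u is the one for u with one more zero in front, so
-- every occurrence of u in it is preceded by exactly one letter a:
--   e(u) = Σ_a e(a ∷ u),   i.e.   e(0 ∷ u) = e(u) − Σ_{a ≠ 0} e(a ∷ u).
-- Applying this to the leading zeros of a word containing a nonzero letter
-- moves its weight onto words starting with a nonzero letter without
-- changing e_{b,S}.
module Submission where

open import Defs
open import Level using (Level)
open import Data.Nat using (ℕ; _≤_; NonZero)
open import Data.Product using (Σ; _×_)
open import Algebra.Bundles using (AbelianGroup; Group)
open import Algebra.Morphism.Structures using (IsGroupHomomorphism)

open import Data.Nat as ℕ using (_+_)
open import Data.Nat.Properties using (+-0-commutativeMonoid; +-identityʳ)
open import Data.Nat.DivMod using (_mod_)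
open import Data.Fin using (Fin; zero; suc)
open import Data.Fin.Properties using () renaming (_≟_ to _≟F_)
open import Data.Bool using (Bool; _∧_)
open import Data.List using ([]; _∷_; _++_; [_]; replicate; length; tabulate)
open import Data.List.Relation.Unary.All using ([]; _∷_)
open import Data.List.Relation.Unary.All.Properties using (++⁺; tabulate⁺)
open import Data.Product using (_,_)
open import Data.Sum using (inj₁; inj₂)
open import Data.Empty using (⊥-elim)
open import Relation.Nullary.Decidable using (⌊_⌋; ⌊⌋-map′)
open import Relation.Binary.PropositionalEquality as ≡
  using (_≡_; cong; module ≡-Reasoning)
open import Algebra.Properties.CommutativeMonoid.Sum +-0-commutativeMonoid
  using (sum-syntax; ∑-distrib-+; sum-replicate-zero; sum-cong-≗)

∑-bit-≟-∧ : ∀ {b} (y : Fin b) (p : Bool) → ∑[ a < b ] bit (⌊ a ≟F y ⌋ ∧ p) ≡ bit p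
∑-bit-≟-∧ {ℕ.suc b} zero    p = ≡.trans (cong (bit p +_) (sum-replicate-zero b)) (+-identityʳ (bit p))
∑-bit-≟-∧ {ℕ.suc b} (suc y) p =
  ≡.trans (sum-cong-≗ (λ a → cong (λ q → bit (q ∧ p)) (⌊⌋-map′ _ _ (a ≟F y)))) (∑-bit-≟-∧ y p)

∑-occurrences-∷-∷ : ∀ {b} (u : Word b) (y : Fin b) (t : Word b) →
  ∑[ a < b ] occurrences (a ∷ u) (y ∷ t) ≡ bit (isPrefix u t) + ∑[ a < b ] occurrences (a ∷ u) t
∑-occurrences-∷-∷ u y t =
  ≡.trans (∑-distrib-+ (λ a → bit (⌊ a ≟F y ⌋ ∧ isPrefix u t)) (λ a → occurrences (a ∷ u) t))
          (cong (_+ ∑[ a < _ ] occurrences (a ∷ u) t) (∑-bit-≟-∧ y (isPrefix u t)))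

∑-occurrences-∷ : ∀ {b} (u : Word b) (y : Fin b) (t : Word b) →
  ∑[ a < b ] occurrences (a ∷ u) (y ∷ t) ≡ occurrences u t
∑-occurrences-∷ {b} u y [] = begin
  ∑[ a < b ] occurrences (a ∷ u) (y ∷ [])  ≡⟨ ∑-occurrences-∷-∷ u y [] ⟩
  bit (isPrefix u []) + ∑[ a < b ] 0       ≡⟨ cong (bit (isPrefix u []) +_) (sum-replicate-zero b) ⟩
  bit (isPrefix u []) + 0                  ≡⟨ +-identityʳ _ ⟩
  occurrences u []                         ∎
  where open ≡-Reasoning
∑-occurrences-∷ {b} u y (z ∷ t) = begin
  ∑[ a < b ] occurrences (a ∷ u) (y ∷ z ∷ t)            ≡⟨ ∑-occurrences-∷-∷ u y (z ∷ t) ⟩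
  bit (isPrefix u (z ∷ t)) + ∑[ a < b ] occurrences (a ∷ u) (z ∷ t)
                                                        ≡⟨ cong (bit (isPrefix u (z ∷ t)) +_) (∑-occurrences-∷ u z t) ⟩
  occurrences u (z ∷ t)                                 ∎
  where open ≡-Reasoning

∑-e-∷ : ∀ b .{{_ : NonZero b}} (u : Word b) (n : ℕ) → ∑[ a < b ] e b (a ∷ u) n ≡ e b u n
∑-e-∷ b u n = ∑-occurrences-∷ u (0 mod b) (replicate (length u) (0 mod b) ++ expansion b n)

module _ {c ℓ : Level} (G : AbelianGroup c ℓ) where
  open AbelianGroup G
  open import Algebra.Definitions.RawMonoid rawMonoid using () renaming (_×_ to _·ℕ_)
  open import Algebra.Properties.Monoid.Mult monoid using (×-homo-+; ×-congʳ; ×-congˡ)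
  open import Algebra.Properties.Monoid.Sum monoid using ()
    renaming (sum-replicate to ∑G-replicate; sum-replicate-zero to ∑G-replicate-ε)
  open import Algebra.Properties.CommutativeMonoid.Mult commutativeMonoid using (×-distrib-+)
  open import Relation.Binary.Reasoning.Setoid setoid

  ×-ε : ∀ k → k ·ℕ ε ≈ ε
  ×-ε k = trans (sym (∑G-replicate k)) (∑G-replicate-ε k)

  ×≈+×∙×⁻¹ : ∀ k j x → k ·ℕ x ≈ (k + j) ·ℕ x ∙ j ·ℕ (x ⁻¹)
  ×≈+×∙×⁻¹ k j x = begin
    k ·ℕ x                              ≈⟨ sym (identityʳ _) ⟩
    k ·ℕ x ∙ ε                          ≈⟨ ∙-congˡ (sym (×-ε j)) ⟩
    k ·ℕ x ∙ j ·ℕ ε                     ≈⟨ ∙-congˡ (×-congʳ j (sym (inverseʳ x))) ⟩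
    k ·ℕ x ∙ j ·ℕ (x ∙ x ⁻¹)            ≈⟨ ∙-congˡ (×-distrib-+ x (x ⁻¹) j) ⟩
    k ·ℕ x ∙ (j ·ℕ x ∙ j ·ℕ (x ⁻¹))     ≈⟨ sym (assoc _ _ _) ⟩
    k ·ℕ x ∙ j ·ℕ x ∙ j ·ℕ (x ⁻¹)       ≈⟨ ∙-congʳ (sym (×-homo-+ x k j)) ⟩
    (k + j) ·ℕ x ∙ j ·ℕ (x ⁻¹)          ∎

  module _ (b : ℕ) .{{_ : NonZero b}} where

    eS-++ : ∀ (S T : WSubset G b) n → eS G b (S ++ T) n ≈ eS G b S n ∙ eS G b T n
    eS-++ []            T n = sym (identityˡ _)
    eS-++ ((w , x) ∷ S) T n = trans (∙-congˡ (eS-++ S T n)) (sym (assoc _ _ _))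

    eS-tabulate : ∀ {k} (w : Fin k → Word b) x n →
                  eS G b (tabulate (λ i → (w i , x))) n ≈ (∑[ i < k ] e b (w i) n) ·ℕ x
    eS-tabulate {ℕ.zero}  w x n = refl
    eS-tabulate {ℕ.suc k} w x n =
      trans (∙-congˡ (eS-tabulate (λ i → w (suc i)) x n))
            (sym (×-homo-+ x (e b (w zero) n) (∑[ i < k ] e b (w (suc i)) n)))

  nonzeroExtensions : ∀ {b} → Word (ℕ.suc b) → Carrier → WSubset G (ℕ.suc b)
  nonzeroExtensions u x = tabulate (λ a → (suc a ∷ u , x))

  properTerms : ∀ {b} (w : Word b) → HasNonzero w → Carrier → WSubset G b
  properTerms (zero  ∷ u) (inj₁ 0≢0) x = ⊥-elim (0≢0 ≡.refl)
  properTerms (zero  ∷ u) (inj₂ u≢0) x = properTerms u u≢0 x ++ nonzeroExtensions u (x ⁻¹)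
  properTerms (suc a ∷ u) _          x = [ (suc a ∷ u , x) ]

  properTerms-proper : ∀ {b} (w : Word b) w≢0 x → Proper G (properTerms w w≢0 x)
  properTerms-proper (zero  ∷ u) (inj₁ 0≢0) x = ⊥-elim (0≢0 ≡.refl)
  properTerms-proper (zero  ∷ u) (inj₂ u≢0) x =
    ++⁺ (properTerms-proper u u≢0 x) (tabulate⁺ (λ _ ()))
  properTerms-proper (suc a ∷ u) _          x = (λ ()) ∷ []

  eS-properTerms : ∀ {b} .{{_ : NonZero b}} (w : Word b) w≢0 x n →
                   e b w n ·ℕ x ≈ eS G b (properTerms w w≢0 x) n
  eS-properTerms (zero  ∷ u) (inj₁ 0≢0) x n = ⊥-elim (0≢0 ≡.refl)
  eS-properTerms {b} (zero  ∷ u) (inj₂ u≢0) x n = begin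
    e₀ ·ℕ x                                        ≈⟨ ×≈+×∙×⁻¹ e₀ eₙ x ⟩
    (e₀ + eₙ) ·ℕ x ∙ eₙ ·ℕ (x ⁻¹)                  ≈⟨ ∙-congʳ (×-congˡ (∑-e-∷ b u n)) ⟩
    e b u n ·ℕ x ∙ eₙ ·ℕ (x ⁻¹)                    ≈⟨ ∙-cong (eS-properTerms u u≢0 x n)
                                                             (sym (eS-tabulate b (λ a → suc a ∷ u) (x ⁻¹) n)) ⟩
    eS G b (properTerms u u≢0 x) n ∙ eS G b (nonzeroExtensions u (x ⁻¹)) n
                                                   ≈⟨ sym (eS-++ b (properTerms u u≢0 x) _ n) ⟩
    eS G b (properTerms (zero ∷ u) (inj₂ u≢0) x) n ∎
    where
    e₀ eₙ : ℕ
    e₀ = e b (zero ∷ u) n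
    eₙ = ∑[ a < _ ] e b (suc a ∷ u) n
  eS-properTerms (suc a ∷ u) _ x n = sym (identityʳ _)

  properize : ∀ {b} (S : WSubset G b) → WellFormed G S → WSubset G b
  properize []            []         = []
  properize ((w , x) ∷ S) (w≢0 ∷ wf) = properTerms w w≢0 x ++ properize S wf

  properize-proper : ∀ {b} (S : WSubset G b) wf → Proper G (properize S wf)
  properize-proper []            []         = []
  properize-proper ((w , x) ∷ S) (w≢0 ∷ wf) =
    ++⁺ (properTerms-proper w w≢0 x) (properize-proper S wf)

  eS-properize : ∀ b .{{_ : NonZero b}} (S : WSubset G b) wf n → eS G b S n ≈ eS G b (properize S wf) n
  eS-properize b []            []         n = refl
  eS-properize b ((w , x) ∷ S) (w≢0 ∷ wf) n =
    trans (∙-cong (eS-properTerms w w≢0 x n) (eS-properize b S wf n))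
          (sym (eS-++ b (properTerms w w≢0 x) (properize S wf) n))

proposition2 : ∀ {c ℓ c′ ℓ′ : Level} (G : AbelianGroup c ℓ) (H : Group c′ ℓ′)
                 (χ : AbelianGroup.Carrier G → Group.Carrier H) →
                 IsGroupHomomorphism (AbelianGroup.rawGroup G) (Group.rawGroup H) χ →
                 (b : ℕ) .{{_ : NonZero b}} → 2 ≤ b →
                 (S : WSubset G b) → WellFormed G S →
                 Σ (WSubset G b) λ S′ → Proper G S′ ×
                   (∀ (n : ℕ) → Group._≈_ H (χ (eS G b S n)) (χ (eS G b S′ n)))
proposition2 G H χ χ-hom b _ S wf =
  properize G S wf , properize-proper G S wf ,
  λ n → IsGroupHomomorphism.⟦⟧-cong χ-hom (eS-properize G b S wf n)
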